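{- Let $n\geq 1$. The set of binary words of length $n$ encoding the states of the $n$-twist loop $T_n$ with exactly two components is $\mathcal{T}_1=\{0\}$ for $n=1$, and for $n\geq 2$ it is \[ \mathcal{T}_n=\{1^k\,0\,1^{\,n-k-1} : 0\leq k\leq n-1\}. \] (For $n=0$, $\mathcal{T}_0=\varnothing$.)
   Context: For $n\ge 0$, let $R_n$ be a horizontal twist region: two strands running left to right that cross each other $n$ times consecutively (for $n=0$ two parallel segments), with left ends NW, SW and right ends NE, SE. The $n$-twist loop $T_n$ is the plane closed curve obtained by joining NW to SW by an arc on the left and NE to SE by an arc on the right; it has crossings $c_1,\dots,c_n$ from left to right and bounds $n+1$ lobes in a row. Its regions are checkerboard coloured, and the regions of the colour of the unbounded region are called $A$-regions, the others $B$-regions. Each crossing $c_i$ has four corners: two opposite corners in the unbounded region ($A$-corners) and two in the lobes to its left and right ($B$-corners). Splitting a crossing means deleting a small neighbourhood of it and reconnecting the four loose ends by two disjoint arcs; the $A$-split merges the two $A$-corners into one region, the $B$-split merges the two $B$-corners. A state is obtained by splitting every crossing; it is a disjoint union of simple closed curves. A state is encoded by the word $\sigma_1\cdots\sigma_n$ with $\sigma_i=0$ if the $A$-split was applied at $c_i$ and $\sigma_i=1$ if the $B$-split was applied. $w^k$ denotes $k$ concatenated copies of $w$. -}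

module Defs where

open import Data.Nat using (ℕ; zero; suc; _∸_; _<_)
open import Data.Fin using (Fin; zero; suc; inject₁; fromℕ)
open import Data.Bool using (Bool; true; false)
open import Data.Product using (_×_; _,_; ∃-syntax)
open import Data.Sum using (_⊎_)
open import Data.Vec using (Vec; lookup; toList)
open import Data.List using (List; replicate; _++_; _∷_)
open import Relation.Nullary using (¬_)
open import Relation.Binary.PropositionalEquality using (_≡_)
open import Relation.Binary.Construct.Closure.Equivalence using (EqClosure)

-- A state word: entry i is 0 (A-split at crossing c_{i+1}) or 1 (B-split).
Word : ℕ → Set
Word n = Vec (Fin 2) n

-- Lobes L_0 … L_n (the B-regions) are indexed by Fin (suc n); crossing c_{i+1}
-- (i : Fin n) sits between lobe inject₁ i and lobe suc i.
-- The curve is cut into arcs: (j , true) is the upper boundary arc of lobe j,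
-- (j , false) the lower boundary arc.  For the end lobes L_0 and L_n the
-- boundary is a single arc (left / right closing arc), which we cut into an
-- upper and a lower half joined at its extreme point (constructors arcL, arcR).
Arc : ℕ → Set
Arc n = Fin (suc n) × Bool

-- At crossing i the four loose ends are: upper/lower arcs of the left lobe
-- (inject₁ i) and upper/lower arcs of the right lobe (suc i).  The top and
-- bottom corners lie in the unbounded (A) region, the left/right corners in
-- the lobes (B-regions).
--   A-split (σ_i = 0): merges top and bottom corners, i.e. reconnects
--     left-upper with left-lower and right-upper with right-lower.
--   B-split (σ_i = 1): merges left and right lobes, i.e. reconnects
--     left-upper with right-upper and left-lower with right-lower.
data Join {n : ℕ} (σ : Word n) : Arc n → Arc n → Set where
  arcL : Join σ (zero , true) (zero , false)
  arcR : Join σ (fromℕ n , true) (fromℕ n , false)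
  splitA-left  : (i : Fin n) → lookup σ i ≡ zero →
                 Join σ (inject₁ i , true) (inject₁ i , false)
  splitA-right : (i : Fin n) → lookup σ i ≡ zero →
                 Join σ (suc i , true) (suc i , false)
  splitB-up    : (i : Fin n) → lookup σ i ≡ suc zero →
                 Join σ (inject₁ i , true) (suc i , true)
  splitB-low   : (i : Fin n) → lookup σ i ≡ suc zero →
                 Join σ (inject₁ i , false) (suc i , false)

SameComponent : {n : ℕ} (σ : Word n) → Arc n → Arc n → Set
SameComponent σ = EqClosure (Join σ)

HasTwoComponents : {n : ℕ} → Word n → Set
HasTwoComponents {n} σ =
  ∃[ x ] ∃[ y ] (¬ SameComponent σ x y ×
                 ((z : Arc n) → SameComponent σ z x ⊎ SameComponent σ z y))

tWord : ℕ → ℕ → List (Fin 2)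
tWord n k = replicate k (suc zero) ++ (zero ∷ replicate (n ∸ suc k) (suc zero))

Inℐ : (n : ℕ) → Word n → Set
Inℐ n σ = ∃[ k ] (k < n × toList σ ≡ tWord n k)

module Submission where

-- Give lobe L_j the *level* = number of A-splits among the
-- crossings c_1 … c_j to its left.  Every join of the state (closing arcs,
-- A-splits, which stay inside one lobe, and B-splits, which link two lobes
-- separated by a B-crossing) preserves the level, and conversely any two arcs
-- of equal level are linked (induction on the word, peeling off c_1).  Hence
-- the components of the state are exactly the level sets, and the levels that
-- occur are precisely 0, 1, …, z where z is the number of A-splits; so the
-- state has z + 1 components.  Two components therefore means z ≡ 1, and the
-- words with exactly one 0 are the words 1^k 0 1^(n-k-1).

open import Defs
open import Data.Nat using (ℕ; zero; suc; _+_; _≤_; z≤n; s≤s; pred)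
open import Data.Nat.Properties using (suc-injective; n≤0⇒n≡0)
open import Data.Fin using (Fin; zero; suc; inject₁; fromℕ)
open import Data.Bool using (Bool; true; false)
open import Data.Product using (_,_; proj₁; ∃-syntax)
open import Data.Sum using (_⊎_; inj₁; inj₂)
open import Data.Empty using (⊥; ⊥-elim)
open import Data.Vec using ([]; _∷_; lookup; toList)
open import Data.List using (replicate) renaming (_∷_ to _∷ₗ_)
open import Data.List.Properties using (∷-injective)
open import Function.Bundles using (_⇔_; mk⇔)
open import Relation.Nullary using (¬_)
open import Relation.Binary.PropositionalEquality using (_≡_; _≢_; refl; sym; trans; cong; subst)
open import Relation.Binary.Construct.Closure.ReflexiveTransitive using (ε; _◅_; _◅◅_)
open import Relation.Binary.Construct.Closure.Symmetric using (fwd; bwd)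
import Relation.Binary.Construct.Closure.Equivalence as EqClosure

private
  one : Fin 2
  one = suc zero

isA : Fin 2 → ℕ
isA zero    = 1
isA (suc _) = 0

zeros : ∀ {n} → Word n → ℕ
zeros []      = 0
zeros (a ∷ σ) = isA a + zeros σ

level : ∀ {n} → Word n → Fin (suc n) → ℕ
level σ       zero    = 0
level (a ∷ σ) (suc j) = isA a + level σ j

arcLevel : ∀ {n} → Word n → Arc n → ℕ
arcLevel σ x = level σ (proj₁ x)

level-last : ∀ {n} (σ : Word n) → level σ (fromℕ n) ≡ zeros σ
level-last []      = refl
level-last (a ∷ σ) = cong (isA a +_) (level-last σ)

level≤zeros : ∀ {n} (σ : Word n) (j : Fin (suc n)) → level σ j ≤ zeros σ
level≤zeros σ           zero    = z≤n
level≤zeros (zero ∷ σ)  (suc j) = s≤s (level≤zeros σ j)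
level≤zeros (suc _ ∷ σ) (suc j) = level≤zeros σ j

-- Levels increase in steps of at most one, so every value up to the
-- maximum is the level of some lobe.
level-attained : ∀ {n} (σ : Word n) (v : ℕ) → v ≤ zeros σ → ∃[ j ] level σ j ≡ v
level-attained σ           zero    _       = zero , refl
level-attained (zero ∷ σ)  (suc v) (s≤s v≤) with level-attained σ v v≤
... | j , lj≡v = suc j , cong suc lj≡v
level-attained (suc _ ∷ σ) (suc v) v≤      with level-attained σ (suc v) v≤
... | j , lj≡v = suc j , lj≡v

level-across-B : ∀ {n} (σ : Word n) (i : Fin n) → lookup σ i ≡ one →
                 level σ (inject₁ i) ≡ level σ (suc i)
level-across-B (_ ∷ σ) zero    refl = refl
level-across-B (a ∷ σ) (suc i) σi≡1 = cong (isA a +_) (level-across-B σ i σi≡1)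

join-preserves-level : ∀ {n} (σ : Word n) {x y : Arc n} →
                       Join σ x y → arcLevel σ x ≡ arcLevel σ y
join-preserves-level σ arcL                 = refl
join-preserves-level σ arcR                 = refl
join-preserves-level σ (splitA-left  _ _)   = refl
join-preserves-level σ (splitA-right _ _)   = refl
join-preserves-level σ (splitB-up  i σi≡1)  = level-across-B σ i σi≡1
join-preserves-level σ (splitB-low i σi≡1)  = level-across-B σ i σi≡1

component-preserves-level : ∀ {n} (σ : Word n) {x y : Arc n} →
                            SameComponent σ x y → arcLevel σ x ≡ arcLevel σ y
component-preserves-level σ ε            = refl
component-preserves-level σ (fwd j ◅ xs) =
  trans (join-preserves-level σ j) (component-preserves-level σ xs)
component-preserves-level σ (bwd j ◅ xs) =
  trans (sym (join-preserves-level σ j)) (component-preserves-level σ xs)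

link : ∀ {n} {σ : Word n} {x y : Arc n} → Join σ x y → SameComponent σ x y
link j = fwd j ◅ ε

flip : ∀ {n} {σ : Word n} {x y : Arc n} → SameComponent σ x y → SameComponent σ y x
flip {σ = σ} = EqClosure.symmetric (Join σ)

leftmost-lobe : ∀ {n} (σ : Word n) (b b′ : Bool) → SameComponent σ (zero , b) (zero , b′)
leftmost-lobe σ true  true  = ε
leftmost-lobe σ true  false = link arcL
leftmost-lobe σ false true  = flip (link arcL)
leftmost-lobe σ false false = ε

-- Removing crossing c_1 from a ∷ σ turns lobes L_1 … L_n into the lobes of σ.
shift : ∀ {n} → Arc n → Arc (suc n)
shift (j , b) = suc j , b

-- The upper and lower arcs of L_1 are joined, through c_2's side if c_1 is an
-- A-split, and around L_0 if c_1 is a B-split.  This replaces the closing arc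
-- of σ's leftmost lobe.
second-lobe : ∀ {n} (a : Fin 2) (σ : Word n) →
              SameComponent (a ∷ σ) (suc zero , true) (suc zero , false)
second-lobe zero       σ = link (splitA-right zero refl)
second-lobe (suc zero) σ =
  bwd (splitB-up zero refl) ◅ fwd arcL ◅ fwd (splitB-low zero refl) ◅ ε

shift-join : ∀ {n} (a : Fin 2) (σ : Word n) {x y : Arc n} →
             Join σ x y → SameComponent (a ∷ σ) (shift x) (shift y)
shift-join a σ arcL                  = second-lobe a σ
shift-join a σ arcR                  = link arcR
shift-join a σ (splitA-left  i σi≡0) = link (splitA-left  (suc i) σi≡0)
shift-join a σ (splitA-right i σi≡0) = link (splitA-right (suc i) σi≡0)
shift-join a σ (splitB-up    i σi≡1) = link (splitB-up    (suc i) σi≡1)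
shift-join a σ (splitB-low   i σi≡1) = link (splitB-low   (suc i) σi≡1)

shift-component : ∀ {n} (a : Fin 2) (σ : Word n) {x y : Arc n} →
                  SameComponent σ x y → SameComponent (a ∷ σ) (shift x) (shift y)
shift-component a σ ε            = ε
shift-component a σ (fwd j ◅ xs) = shift-join a σ j ◅◅ shift-component a σ xs
shift-component a σ (bwd j ◅ xs) = flip (shift-join a σ j) ◅◅ shift-component a σ xs

across-first-B : ∀ {n} (σ : Word n) (b : Bool) →
                 SameComponent (one ∷ σ) (zero , b) (suc zero , b)
across-first-B σ true  = link (splitB-up  zero refl)
across-first-B σ false = link (splitB-low zero refl)

equal-level-connected : ∀ {n} (σ : Word n) (x y : Arc n) →
                        arcLevel σ x ≡ arcLevel σ y → SameComponent σ x y
equal-level-connected σ (zero , b) (zero , b′) _ = leftmost-lobe σ b b′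
equal-level-connected (zero ∷ σ) (suc j , b) (suc j′ , b′) eq =
  shift-component zero σ (equal-level-connected σ (j , b) (j′ , b′) (suc-injective eq))
equal-level-connected (suc zero ∷ σ) (suc j , b) (suc j′ , b′) eq =
  shift-component one σ (equal-level-connected σ (j , b) (j′ , b′) eq)
equal-level-connected (suc zero ∷ σ) (zero , b) (suc j′ , b′) eq =
  across-first-B σ b ◅◅ shift-component one σ (equal-level-connected σ (zero , b) (j′ , b′) eq)
equal-level-connected (suc zero ∷ σ) (suc j , b) (zero , b′) eq =
  shift-component one σ (equal-level-connected σ (j , b) (zero , b′) eq) ◅◅ flip (across-first-B σ b′)

two-values : ∀ {u w t : ℕ} → u ≢ w → u ≤ t → w ≤ t →
             (∀ v → v ≤ t → v ≡ u ⊎ v ≡ w) → t ≡ 1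
two-values {t = zero} u≢w u≤0 w≤0 _ = ⊥-elim (u≢w (trans (n≤0⇒n≡0 u≤0) (sym (n≤0⇒n≡0 w≤0))))
two-values {t = suc zero} _ _ _ _ = refl
two-values {t = suc (suc t)} u≢w _ _ cover =
  ⊥-elim (three-values (cover 0 z≤n) (cover 1 (s≤s z≤n)) (cover 2 (s≤s (s≤s z≤n))))
  where
  three-values : ∀ {u w} → 0 ≡ u ⊎ 0 ≡ w → 1 ≡ u ⊎ 1 ≡ w → 2 ≡ u ⊎ 2 ≡ w → ⊥
  three-values (inj₁ refl) (inj₂ refl) (inj₁ ())
  three-values (inj₁ refl) (inj₂ refl) (inj₂ ())
  three-values (inj₂ refl) (inj₁ refl) (inj₁ ())
  three-values (inj₂ refl) (inj₁ refl) (inj₂ ())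
  three-values (inj₁ refl) (inj₁ ()) _
  three-values (inj₂ refl) (inj₂ ()) _

two-components⇒one-zero : ∀ {n} (σ : Word n) → HasTwoComponents σ → zeros σ ≡ 1
two-components⇒one-zero σ (x , y , x≁y , cover) =
  two-values levels-differ (level≤zeros σ (proj₁ x)) (level≤zeros σ (proj₁ y)) every-level
  where
  levels-differ : arcLevel σ x ≢ arcLevel σ y
  levels-differ eq = x≁y (equal-level-connected σ x y eq)
  every-level : ∀ v → v ≤ zeros σ → v ≡ arcLevel σ x ⊎ v ≡ arcLevel σ y
  every-level v v≤ with level-attained σ v v≤
  ... | j , refl with cover (j , true)
  ...   | inj₁ z~x = inj₁ (component-preserves-level σ z~x)
  ...   | inj₂ z~y = inj₂ (component-preserves-level σ z~y)

-- With one A-split, the leftmost lobe (level 0) and the rightmost lobe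
-- (level 1) represent the two components.
one-zero⇒two-components : ∀ {n} (σ : Word n) → zeros σ ≡ 1 → HasTwoComponents σ
one-zero⇒two-components {n} σ z≡1 = left , right , left≁right , cover
  where
  left right : Arc n
  left  = zero , true
  right = fromℕ n , true
  level-right : arcLevel σ right ≡ 1
  level-right = trans (level-last σ) z≡1
  left≁right : ¬ SameComponent σ left right
  left≁right c with trans (component-preserves-level σ c) level-right
  ... | ()
  cover : (z : Arc n) → SameComponent σ z left ⊎ SameComponent σ z right
  cover (j , b) with level σ j in lj | level≤zeros σ j
  ... | zero        | _ = inj₁ (equal-level-connected σ (j , b) left lj)
  ... | suc zero    | _ = inj₂ (equal-level-connected σ (j , b) right (trans lj (sym level-right)))
  ... | suc (suc _) | l≤z with subst (_ ≤_) z≡1 l≤z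
  ...   | s≤s ()

no-zero⇒all-ones : ∀ {n} (σ : Word n) → zeros σ ≡ 0 → toList σ ≡ replicate n one
no-zero⇒all-ones []             _  = refl
no-zero⇒all-ones (suc zero ∷ σ) z≡0 = cong (one ∷ₗ_) (no-zero⇒all-ones σ z≡0)

all-ones⇒no-zero : ∀ {n} (σ : Word n) → toList σ ≡ replicate n one → zeros σ ≡ 0
all-ones⇒no-zero []      _  = refl
all-ones⇒no-zero (a ∷ σ) eq with ∷-injective eq
... | refl , rest = all-ones⇒no-zero σ rest

one-zero⇒inℐ : ∀ {n} (σ : Word n) → zeros σ ≡ 1 → Inℐ n σ
one-zero⇒inℐ (zero ∷ σ) z≡1 =
  0 , s≤s z≤n , cong (zero ∷ₗ_) (no-zero⇒all-ones σ (cong pred z≡1))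
one-zero⇒inℐ (suc zero ∷ σ) z≡1 with one-zero⇒inℐ σ z≡1
... | k , k<n , eq = suc k , s≤s k<n , cong (one ∷ₗ_) eq

inℐ⇒one-zero : ∀ {n} (σ : Word n) → Inℐ n σ → zeros σ ≡ 1
inℐ⇒one-zero (a ∷ σ) (zero , _ , eq) with ∷-injective eq
... | refl , rest = cong suc (all-ones⇒no-zero σ rest)
inℐ⇒one-zero (a ∷ σ) (suc k , s≤s k<n , eq) with ∷-injective eq
... | refl , rest = inℐ⇒one-zero σ (k , k<n , rest)

mainTheorem12 : (n : ℕ) → (σ : Word n) → HasTwoComponents σ ⇔ Inℐ n σ
mainTheorem12 n σ =
  mk⇔ (λ two → one-zero⇒inℐ σ (two-components⇒one-zero σ two))
      (λ inℐ → one-zero⇒two-components σ (inℐ⇒one-zero σ inℐ))
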